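{- Let $q$ be an odd prime power, $d$ a positive integer, $\varphi_d$ the coloring defined in the context, and let $p \geq 2$ and $T \geq 0$ be integers. Let $S \subseteq (\mathbb{F}_q^*)^d$ be a set of $p$ vectors with a leftover structure under $\varphi_d$. If $T \geq 1$, suppose further that $a_1, \ldots, a_T \in (\mathbb{F}_q^*)^d$ and $\alpha_1, \ldots, \alpha_T \in C_d$ satisfy $\varphi_d(a_i, a_j) = \alpha_i$ for all $1 \leq i < j \leq T$ and $\varphi_d(a_i, s) = \alpha_i$ for all $1 \leq i \leq T$ and all $s \in S$. Then there exists a sequence of positive integers $x_1, \ldots, x_t$ with $\sum_{i=1}^t x_i = p-1$ such that for each $i = 1, \ldots, t$, writing $\sigma_1 = 0$ and $\sigma_i = \sum_{j=1}^{i-1} x_j$ for $i \ge 2$: (1) $1 \leq x_i \leq \lfloor (p - \sigma_i)/2 \rfloor$; (2) $\lceil \log_2 x_i \rceil + \lceil \log_2 (p - \sigma_i - x_i) \rceil \leq d-1$; (3) $\lceil \log_2 (p - \sigma_i - x_i) \rceil \leq d - i - T$.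
   Context: $\mathbb{F}_q^*$ is the set of nonzero elements of $\mathbb{F}_q$, with an arbitrary fixed linear order; $(\mathbb{F}_q^*)^d$ is ordered lexicographically. $C_d = \mathrm{DOT} \sqcup \mathrm{ZERO} \sqcup \mathrm{UP} \sqcup \mathrm{DOWN}$, with $\mathrm{DOT} = \mathbb{F}_q^*$ and ZERO, UP, DOWN disjoint copies of $\{1,\ldots,d\}\times\mathbb{F}_q$. For distinct $x<y$, with $i$ the first coordinate where they differ and $\cdot$ the standard dot product, $\varphi_d(x,y)=\varphi_d(y,x)$ equals $(i,x_i+y_i)_{\mathrm{ZERO}}$ if $x\cdot y=0$; $(i,x_i+y_i)_{\mathrm{UP}}$ if $x\cdot y\neq 0$ and $x\cdot y = x\cdot x$; $(i,x_i+y_i)_{\mathrm{DOWN}}$ if $x\cdot y\notin\{0,x\cdot x\}$ and $x\cdot y = y\cdot y$; and $x\cdot y\in\mathrm{DOT}$ otherwise. For a vertex set $X$, $\varphi_d(X)$ is the set of colors on pairs inside $X$. $S$ has a leftover structure under $\varphi_d$ if $|S|=1$ or there is a partition $S = A\cup B$ into nonempty sets with $A$, $B$ each having a leftover structure, $\varphi_d(A)\cap\varphi_d(B)=\emptyset$, and a color $\gamma$ with $\varphi_d(a,b)=\gamma$ for all $a\in A, b\in B$ and $\gamma\notin\varphi_d(A)\cup\varphi_d(B)$. -}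

module Defs where

open import Level using (0ℓ)
open import Data.Nat as ℕ using (ℕ; zero; suc)
open import Data.Fin using (Fin; toℕ)
import Data.Fin
open import Data.Vec using (Vec; []; _∷_; lookup; foldr; zipWith)
open import Data.Maybe using (Maybe; just; nothing)
open import Data.Product using (Σ; ∃; _×_; _,_)
open import Data.List using (List; length; [_]; _++_)
open import Data.List.Membership.Propositional using (_∈_)
open import Data.List.Relation.Binary.Permutation.Propositional using (_↭_)
open import Relation.Nullary using (¬_; Dec; yes; no)
open import Relation.Binary using (IsStrictTotalOrder)
open import Relation.Binary.PropositionalEquality using (_≡_; _≢_)
open import Algebra.Structures using (IsCommutativeRing)
open import Function.Bundles using (_↔_)
open import Data.Nat.Primality using (Prime)

record FiniteField (q : ℕ) : Set₁ where
  field
    Carrier  : Set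
    _+_ _*_  : Carrier → Carrier → Carrier
    -_       : Carrier → Carrier
    0# 1#    : Carrier
    isCommutativeRing : IsCommutativeRing _≡_ _+_ _*_ -_ 0# 1#
    0≢1      : 0# ≢ 1#
    inverse  : ∀ x → x ≢ 0# → Σ Carrier (λ y → x * y ≡ 1#)
    _≟_      : (x y : Carrier) → Dec (x ≡ y)
    enum     : Fin q ↔ Carrier

OddPrimePower : ℕ → Set
OddPrimePower q = Σ ℕ λ r → Σ ℕ λ k → Prime r × r ≢ 2 × k ℕ.≥ 1 × q ≡ r ℕ.^ k

data Color {q : ℕ} (𝔽 : FiniteField q) (d : ℕ) : Set where
  DOT  : FiniteField.Carrier 𝔽 → Color 𝔽 d            -- only used with nonzero values
  ZERO : Fin d → FiniteField.Carrier 𝔽 → Color 𝔽 d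
  UP   : Fin d → FiniteField.Carrier 𝔽 → Color 𝔽 d
  DOWN : Fin d → FiniteField.Carrier 𝔽 → Color 𝔽 d

module _ {q : ℕ} (𝔽 : FiniteField q)
         (_≺_ : FiniteField.Carrier 𝔽 → FiniteField.Carrier 𝔽 → Set)
         (≺-sto : IsStrictTotalOrder _≡_ _≺_) where

  open FiniteField 𝔽
  F = Carrier

  NonzeroVec : {d : ℕ} → Vec F d → Set
  NonzeroVec {d} x = ∀ (i : Fin d) → lookup x i ≢ 0#

  dot : {d : ℕ} → Vec F d → Vec F d → F
  dot x y = foldr _ _+_ 0# (zipWith _*_ x y)

  firstDiff : {d : ℕ} → Vec F d → Vec F d → Maybe (Fin d)
  firstDiff []       []       = nothing
  firstDiff (a ∷ x) (b ∷ y) with a ≟ b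
  ... | no _  = just Data.Fin.zero
  ... | yes _ with firstDiff x y
  ...   | nothing = nothing
  ...   | just i  = just (Data.Fin.suc i)

  -- colour of the pair where u is the lexicographically smaller vector,
  -- i the first differing coordinate
  colorOrd : {d : ℕ} → Vec F d → Vec F d → Fin d → Color 𝔽 d
  colorOrd u v i with dot u v ≟ 0#
  ... | yes _ = ZERO i (lookup u i + lookup v i)
  ... | no _ with dot u v ≟ dot u u
  ...   | yes _ = UP i (lookup u i + lookup v i)
  ...   | no _ with dot u v ≟ dot v v
  ...     | yes _ = DOWN i (lookup u i + lookup v i)
  ...     | no _  = DOT (dot u v)

  -- φ_d; undefined (nothing) on pairs of equal vectors
  φ : {d : ℕ} → Vec F d → Vec F d → Maybe (Color 𝔽 d)
  φ x y with firstDiff x y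
  ... | nothing = nothing
  ... | just i with IsStrictTotalOrder.compare ≺-sto (lookup x i) (lookup y i)
  ...   | Relation.Binary.tri< _ _ _ = just (colorOrd x y i)
  ...   | Relation.Binary.tri≈ _ _ _ = just (colorOrd x y i)  -- impossible
  ...   | Relation.Binary.tri> _ _ _ = just (colorOrd y x i)

  _∈φ_ : {d : ℕ} → Color 𝔽 d → List (Vec F d) → Set
  γ ∈φ X = ∃ λ a → ∃ λ b → a ∈ X × b ∈ X × φ a b ≡ just γ

  -- leftover structure (sets represented by duplicate-free lists up to permutation)
  data Leftover {d : ℕ} : List (Vec F d) → Set where
    single : ∀ x → Leftover [ x ]
    split  : ∀ {S} A B → Leftover A → Leftover B → S ↭ (A ++ B)
           → (∀ γ → γ ∈φ A → ¬ (γ ∈φ B))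
           → (γ : Color 𝔽 d)
           → (∀ a b → a ∈ A → b ∈ B → φ a b ≡ just γ)
           → ¬ (γ ∈φ A) → ¬ (γ ∈φ B)
           → Leftover S

-- The numerical conclusion.  For a list xs = x_1 … x_t and 0-based index i,
-- σ = x_1 + … + x_i (= σ_{i+1} in the paper's 1-based notation).

open import Data.List using (take) renaming (lookup to lookupL)
open import Data.Nat.ListAction using (sum)
open import Data.Nat using (_≤_; _∸_; _/_) renaming (_+_ to _+ℕ_)
open import Data.Nat.Logarithm using (⌈log₂_⌉)

GoodSequence : (p d T : ℕ) → List ℕ → Set
GoodSequence p d T xs =
  sum xs ≡ p ∸ 1 ×
  (∀ (i : Fin (length xs)) →
     let x = lookupL xs i
         σ = sum (take (toℕ i) xs)
     in 1 ≤ x × x ≤ (p ∸ σ) / 2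
      × ⌈log₂ x ⌉ +ℕ ⌈log₂ (p ∸ σ ∸ x) ⌉ ≤ d ∸ 1
      × ⌈log₂ (p ∸ σ ∸ x) ⌉ +ℕ suc (toℕ i) +ℕ T ≤ d)

-- Write D(Y) for the span of the differences of a set Y of vectors.  A leftover set X
-- splits as A ∪ B with all cross pairs of one colour γ, and γ provides a functional w
-- that is constant on A but separates any b ∈ B from A (w = b itself for a DOT colour,
-- a coordinate vector otherwise).  So b − a ∉ D(A), and by induction dim D(X) ≥ ⌈log₂ |X|⌉.
-- The same colour makes every vector of one side, say B, constant on A, so D(A) is
-- orthogonal to D(B) + F·b; as independent orthogonal families in F_q^d have total size
-- at most d, this gives ⌈log₂ |A|⌉ + ⌈log₂ |B|⌉ ≤ d − 1.  Each a_i is separated from S and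
-- the later a_j in the same way and costs one more dimension.  The sequence is built by
-- splitting off the smaller part as the next term and recursing into the larger one.

module Submission where

open import Defs
open import Data.Nat using (ℕ; zero; suc; z≤n; s≤s; _≤_; _<_; _≤?_; _∸_; _^_; _/_)
  renaming (_+_ to _+ℕ_; _*_ to _*ℕ_)
import Data.Nat.Properties as ℕ
open import Data.Nat.DivMod using (m*n/n≡m; /-monoˡ-≤)
open import Data.Nat.Logarithm using (⌈log₂_⌉; ⌈log₂⌉-mono-≤; ⌈log₂2^n⌉≡n)
open import Data.Nat.ListAction using (sum)
open import Data.Fin using (Fin; toℕ) renaming (_<_ to _<ᶠ_)
import Data.Fin as Fin
open import Data.Vec using (Vec; []; _∷_; lookup; head; tail; foldr; zipWith)
open import Data.List using (List; []; _∷_; map; length; replicate; take; _++_)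
import Data.List as List
open import Data.List.Properties using (length-map; length-replicate; length-++)
open import Data.List.Relation.Unary.All as All using (All; []; _∷_)
open import Data.List.Relation.Unary.Any using (here; there)
open import Data.List.Relation.Unary.Unique.Propositional using (Unique)
open import Data.List.Membership.Propositional using (_∈_)
open import Data.List.Membership.Propositional.Properties using (∈-map⁻; ∈-++⁺ˡ; ∈-++⁺ʳ)
open import Data.List.Relation.Binary.Permutation.Propositional as ↭
  using (_↭_; ↭-refl; ↭-prep; ↭-swap; ↭-trans; ↭-sym)
open import Data.List.Relation.Binary.Permutation.Propositional.Properties
  using (All-resp-↭; ∈-resp-↭; ↭-length)
open import Data.Maybe using (just; nothing)
open import Data.Maybe.Properties using (just-injective)
open import Data.Product using (Σ; ∃; ∃₂; _×_; _,_; proj₁; proj₂)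
open import Data.Sum using (_⊎_; inj₁; inj₂; [_,_]′)
import Data.Sum as Sum
open import Data.Empty using (⊥-elim)
open import Function using (_∘_; flip)
open import Relation.Nullary using (yes; no)
open import Relation.Binary using (IsStrictTotalOrder; tri<; tri≈; tri>)
open import Relation.Binary.PropositionalEquality
  using (_≡_; _≢_; refl; sym; trans; cong; cong₂; subst; subst₂; module ≡-Reasoning)
open import Algebra.Bundles using (CommutativeRing)

⌈log₂⌉≤ : ∀ {n k} → n ≤ 2 ^ k → ⌈log₂ n ⌉ ≤ k
⌈log₂⌉≤ {n} {k} n≤2^k = subst (⌈log₂ n ⌉ ≤_) (⌈log₂2^n⌉≡n k) (⌈log₂⌉-mono-≤ n≤2^k)

+-≤-2^suc : ∀ {a b} k → a ≤ 2 ^ k → b ≤ 2 ^ k → a +ℕ b ≤ 2 ^ suc k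
+-≤-2^suc {a} {b} k a≤ b≤ =
  subst (a +ℕ b ≤_) (cong (2 ^ k +ℕ_) (sym (ℕ.+-identityʳ (2 ^ k)))) (ℕ.+-mono-≤ a≤ b≤)

≤-half : ∀ {m n} → n ≤ m → n ≤ (m +ℕ n) / 2
≤-half {m} {n} n≤m = subst (_≤ (m +ℕ n) / 2) (m*n/n≡m n 2) (/-monoˡ-≤ 2 n*2≤m+n)
  where
  n*2≤m+n : n *ℕ 2 ≤ m +ℕ n
  n*2≤m+n = subst (_≤ m +ℕ n) (trans (cong (n +ℕ_) (sym (ℕ.+-identityʳ n))) (ℕ.*-comm 2 n)) (ℕ.+-monoˡ-≤ n n≤m)

GoodSequence-[] : ∀ {d j} → GoodSequence 1 d j []
GoodSequence-[] = refl , λ ()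

GoodSequence-∷ : ∀ {d j m n xs} → 1 ≤ n → n ≤ m →
                 ⌈log₂ m ⌉ +ℕ ⌈log₂ n ⌉ < d → ⌈log₂ m ⌉ +ℕ suc j ≤ d →
                 GoodSequence m d (suc j) xs → GoodSequence (m +ℕ n) d j (n ∷ xs)
GoodSequence-∷ {d} {j} {m} {n} {xs} 1≤n n≤m logs<d log+j≤d (sum≡ , good) = sum-eq , good′
  where
  open ≡-Reasoning
  sum-eq : n +ℕ sum xs ≡ m +ℕ n ∸ 1
  sum-eq = begin
    n +ℕ sum xs       ≡⟨ cong (n +ℕ_) sum≡ ⟩
    n +ℕ (m ∸ 1)      ≡⟨ sym (ℕ.+-∸-assoc n (ℕ.≤-trans 1≤n n≤m)) ⟩
    n +ℕ m ∸ 1        ≡⟨ cong (_∸ 1) (ℕ.+-comm n m) ⟩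
    m +ℕ n ∸ 1        ∎
  good′ : ∀ (i : Fin (suc (length xs))) →
          let x = List.lookup (n ∷ xs) i
              σ = sum (take (toℕ i) (n ∷ xs))
          in 1 ≤ x × x ≤ (m +ℕ n ∸ σ) / 2
           × ⌈log₂ x ⌉ +ℕ ⌈log₂ (m +ℕ n ∸ σ ∸ x) ⌉ ≤ d ∸ 1
           × ⌈log₂ (m +ℕ n ∸ σ ∸ x) ⌉ +ℕ suc (toℕ i) +ℕ j ≤ d
  good′ Fin.zero rewrite ℕ.m+n∸n≡m m n =
    1≤n , ≤-half n≤m ,
    ℕ.<⇒≤pred (subst (_< d) (ℕ.+-comm ⌈log₂ m ⌉ ⌈log₂ n ⌉) logs<d) ,
    subst (_≤ d) (sym (ℕ.+-assoc ⌈log₂ m ⌉ 1 j)) log+j≤d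
  good′ (Fin.suc i) with good i
  ... | 1≤x , x≤ , logs≤ , log+i+j≤d
    rewrite ℕ.+-comm m n | ℕ.[m+n]∸[m+o]≡n∸o n m (sum (take (toℕ i) xs)) =
    1≤x , x≤ , logs≤ , subst (_≤ d) (index-shift _ (toℕ i)) log+i+j≤d
    where
    index-shift : ∀ a k → a +ℕ suc k +ℕ suc j ≡ a +ℕ suc (suc k) +ℕ j
    index-shift a k = trans (ℕ.+-suc (a +ℕ suc k) j) (sym (cong (_+ℕ j) (ℕ.+-suc a (suc k))))

module LinearAlgebra {q : ℕ} (𝔽 : FiniteField q) where

  open FiniteField 𝔽 using (isCommutativeRing; inverse; 0≢1; _≟_)

  commutativeRing : CommutativeRing _ _
  commutativeRing = record { isCommutativeRing = isCommutativeRing }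

  open CommutativeRing commutativeRing
    using (Carrier; _+_; _*_; -_; _-_; 0#; 1#; +-comm; *-assoc; -‿inverseʳ; +-identityˡ; +-identityʳ;
           *-comm; *-identityˡ; *-identityʳ; zeroˡ; zeroʳ; ring; commutativeSemiring)
  open import Algebra.Properties.Ring ring using (-1*x≈-x; -‿distribˡ-*; x∙y⁻¹≈ε⇒x≈y; x≈y⇒x∙y⁻¹≈ε)
  open import Algebra.Solver.Ring.NaturalCoefficients commutativeSemiring (λ _ _ → nothing)
    using (solve; _:=_; _:+_; _:*_)
  open ≡-Reasoning

  x≢0∧x*y≡0⇒y≡0 : ∀ {x y} → x ≢ 0# → x * y ≡ 0# → y ≡ 0#
  x≢0∧x*y≡0⇒y≡0 {x} {y} x≢0 xy≡0 with inverse x x≢0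
  ... | x⁻¹ , xx⁻¹≡1 = begin
    y               ≡⟨ sym (*-identityˡ y) ⟩
    1# * y          ≡⟨ cong (_* y) (sym xx⁻¹≡1) ⟩
    (x * x⁻¹) * y   ≡⟨ solve 3 (λ x x⁻¹ y → (x :* x⁻¹) :* y := x⁻¹ :* (x :* y)) refl x x⁻¹ y ⟩
    x⁻¹ * (x * y)   ≡⟨ cong (x⁻¹ *_) xy≡0 ⟩
    x⁻¹ * 0#        ≡⟨ zeroʳ x⁻¹ ⟩
    0#              ∎

  V : ℕ → Set
  V = Vec Carrier

  infixl 6 _⊞_ _⊟_
  infixr 7 _∙_

  _⊞_ : ∀ {n} → V n → V n → V n
  []      ⊞ []      = []
  (a ∷ x) ⊞ (b ∷ y) = (a + b) ∷ (x ⊞ y)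

  _∙_ : ∀ {n} → Carrier → V n → V n
  c ∙ []      = []
  c ∙ (a ∷ x) = (c * a) ∷ (c ∙ x)

  _⊟_ : ∀ {n} → V n → V n → V n
  x ⊟ y = x ⊞ (- 1#) ∙ y

  0ᵛ : ∀ {n} → V n
  0ᵛ {zero}  = []
  0ᵛ {suc n} = 0# ∷ 0ᵛ

  -- Literally the body of Defs.dot, so the two agree definitionally.
  ⟨_,_⟩ : ∀ {n} → V n → V n → Carrier
  ⟨ x , y ⟩ = foldr _ _+_ 0# (zipWith _*_ x y)

  ⊞-identityˡ : ∀ {n} (x : V n) → 0ᵛ ⊞ x ≡ x
  ⊞-identityˡ []      = refl
  ⊞-identityˡ (a ∷ x) = cong₂ _∷_ (+-identityˡ a) (⊞-identityˡ x)

  ⊞-comm : ∀ {n} (x y : V n) → x ⊞ y ≡ y ⊞ x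
  ⊞-comm []      []      = refl
  ⊞-comm (a ∷ x) (b ∷ y) = cong₂ _∷_ (+-comm a b) (⊞-comm x y)

  ∙-zeroˡ : ∀ {n} (x : V n) → 0# ∙ x ≡ 0ᵛ
  ∙-zeroˡ []      = refl
  ∙-zeroˡ (a ∷ x) = cong₂ _∷_ (zeroˡ a) (∙-zeroˡ x)

  ⟨⟩-comm : ∀ {n} (x y : V n) → ⟨ x , y ⟩ ≡ ⟨ y , x ⟩
  ⟨⟩-comm []      []      = refl
  ⟨⟩-comm (a ∷ x) (b ∷ y) = cong₂ _+_ (*-comm a b) (⟨⟩-comm x y)

  ⟨⟩-zeroʳ : ∀ {n} (w : V n) → ⟨ w , 0ᵛ ⟩ ≡ 0#
  ⟨⟩-zeroʳ []      = refl
  ⟨⟩-zeroʳ (a ∷ w) = trans (cong₂ _+_ (zeroʳ a) (⟨⟩-zeroʳ w)) (+-identityʳ 0#)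

  ⟨⟩-distribʳ-⊞ : ∀ {n} (w x y : V n) → ⟨ w , x ⊞ y ⟩ ≡ ⟨ w , x ⟩ + ⟨ w , y ⟩
  ⟨⟩-distribʳ-⊞ []      []      []      = sym (+-identityʳ 0#)
  ⟨⟩-distribʳ-⊞ (c ∷ w) (a ∷ x) (b ∷ y) = begin
    c * (a + b) + ⟨ w , x ⊞ y ⟩            ≡⟨ cong (c * (a + b) +_) (⟨⟩-distribʳ-⊞ w x y) ⟩
    c * (a + b) + (⟨ w , x ⟩ + ⟨ w , y ⟩)
      ≡⟨ solve 5 (λ c a b s t → c :* (a :+ b) :+ (s :+ t) := (c :* a :+ s) :+ (c :* b :+ t))
               refl c a b ⟨ w , x ⟩ ⟨ w , y ⟩ ⟩
    (c * a + ⟨ w , x ⟩) + (c * b + ⟨ w , y ⟩) ∎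

  ⟨⟩-∙ʳ : ∀ {n} (w : V n) k (x : V n) → ⟨ w , k ∙ x ⟩ ≡ k * ⟨ w , x ⟩
  ⟨⟩-∙ʳ []      k []      = sym (zeroʳ k)
  ⟨⟩-∙ʳ (c ∷ w) k (a ∷ x) = begin
    c * (k * a) + ⟨ w , k ∙ x ⟩   ≡⟨ cong (c * (k * a) +_) (⟨⟩-∙ʳ w k x) ⟩
    c * (k * a) + k * ⟨ w , x ⟩
      ≡⟨ solve 4 (λ c k a s → c :* (k :* a) :+ k :* s := k :* (c :* a :+ s)) refl c k a ⟨ w , x ⟩ ⟩
    k * (c * a + ⟨ w , x ⟩)       ∎

  ⟨⟩-∙ʳ≡0 : ∀ {n} (w : V n) c {v} → ⟨ w , v ⟩ ≡ 0# → ⟨ w , c ∙ v ⟩ ≡ 0#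
  ⟨⟩-∙ʳ≡0 w c {v} wv≡0 = trans (⟨⟩-∙ʳ w c v) (trans (cong (c *_) wv≡0) (zeroʳ c))

  ⟨⟩-⊟ʳ : ∀ {n} (w x y : V n) → ⟨ w , x ⊟ y ⟩ ≡ ⟨ w , x ⟩ - ⟨ w , y ⟩
  ⟨⟩-⊟ʳ w x y = begin
    ⟨ w , x ⊟ y ⟩                     ≡⟨ ⟨⟩-distribʳ-⊞ w x ((- 1#) ∙ y) ⟩
    ⟨ w , x ⟩ + ⟨ w , (- 1#) ∙ y ⟩    ≡⟨ cong (⟨ w , x ⟩ +_) (trans (⟨⟩-∙ʳ w (- 1#) y) (-1*x≈-x _)) ⟩
    ⟨ w , x ⟩ - ⟨ w , y ⟩             ∎

  ⟨⟩-⊟ʳ≡0 : ∀ {n} (w x y : V n) → ⟨ w , x ⟩ ≡ ⟨ w , y ⟩ → ⟨ w , x ⊟ y ⟩ ≡ 0#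
  ⟨⟩-⊟ʳ≡0 w x y eq = trans (⟨⟩-⊟ʳ w x y) (x≈y⇒x∙y⁻¹≈ε eq)

  ⟨⟩-⊟ʳ≢0 : ∀ {n} (w x y : V n) → ⟨ w , x ⟩ ≢ ⟨ w , y ⟩ → ⟨ w , x ⊟ y ⟩ ≢ 0#
  ⟨⟩-⊟ʳ≢0 w x y neq eq = neq (x∙y⁻¹≈ε⇒x≈y _ _ (trans (sym (⟨⟩-⊟ʳ w x y)) eq))

  ⟨⟩-tail : ∀ {n} (x y : V (suc n)) → head y ≡ 0# → ⟨ tail x , tail y ⟩ ≡ ⟨ x , y ⟩
  ⟨⟩-tail (a ∷ x) (b ∷ y) b≡0 = begin
    ⟨ x , y ⟩            ≡⟨ sym (+-identityˡ _) ⟩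
    0# + ⟨ x , y ⟩       ≡⟨ cong (_+ ⟨ x , y ⟩) (sym (trans (cong (a *_) b≡0) (zeroʳ a))) ⟩
    a * b + ⟨ x , y ⟩    ∎

  e : ∀ {n} → Fin n → V n
  e Fin.zero    = 1# ∷ 0ᵛ
  e (Fin.suc i) = 0# ∷ e i

  ⟨e,⟩≡lookup : ∀ {n} (i : Fin n) (y : V n) → ⟨ e i , y ⟩ ≡ lookup y i
  ⟨e,⟩≡lookup Fin.zero (b ∷ y) = begin
    1# * b + ⟨ 0ᵛ , y ⟩ ≡⟨ cong₂ _+_ (*-identityˡ b) (trans (⟨⟩-comm 0ᵛ y) (⟨⟩-zeroʳ y)) ⟩
    b + 0#              ≡⟨ +-identityʳ b ⟩
    b                   ∎
  ⟨e,⟩≡lookup (Fin.suc i) (b ∷ y) = trans (cong₂ _+_ (zeroˡ b) (⟨e,⟩≡lookup i y)) (+-identityˡ _)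

  lc : ∀ {n} → List Carrier → List (V n) → V n
  lc (c ∷ cs) (v ∷ vs) = c ∙ v ⊞ lc cs vs
  lc _        _        = 0ᵛ

  Independent : ∀ {n} → List (V n) → Set
  Independent L = ∀ cs → length cs ≡ length L → lc cs L ≡ 0ᵛ → All (_≡ 0#) cs

  Orthogonal : ∀ {n} → List (V n) → List (V n) → Set
  Orthogonal U W = ∀ {u w} → u ∈ U → w ∈ W → ⟨ u , w ⟩ ≡ 0#

  []-independent : ∀ {n} → Independent {n} []
  []-independent [] _ _ = []

  ⟨⟩-lc≡0 : ∀ {n} (w : V n) cs {L} → All (λ v → ⟨ w , v ⟩ ≡ 0#) L → ⟨ w , lc cs L ⟩ ≡ 0#
  ⟨⟩-lc≡0 w []       _          = ⟨⟩-zeroʳ w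
  ⟨⟩-lc≡0 w (c ∷ cs) []         = ⟨⟩-zeroʳ w
  ⟨⟩-lc≡0 w (c ∷ cs) {v ∷ L} (wv≡0 ∷ wL≡0) = begin
    ⟨ w , c ∙ v ⊞ lc cs L ⟩          ≡⟨ ⟨⟩-distribʳ-⊞ w (c ∙ v) (lc cs L) ⟩
    ⟨ w , c ∙ v ⟩ + ⟨ w , lc cs L ⟩  ≡⟨ cong₂ _+_ (⟨⟩-∙ʳ≡0 w c wv≡0) (⟨⟩-lc≡0 w cs wL≡0) ⟩
    0# + 0#                          ≡⟨ +-identityʳ 0# ⟩
    0#                               ∎

  ∷-independent : ∀ {n} (w : V n) {u L} → ⟨ w , u ⟩ ≢ 0# → All (λ v → ⟨ w , v ⟩ ≡ 0#) L
                → Independent L → Independent (u ∷ L)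
  ∷-independent w {u} {L} wu≢0 wL≡0 indep (c ∷ cs) len lc≡0 =
    c≡0 ∷ indep cs (ℕ.suc-injective len) lcL≡0
    where
    c*wu≡0 : c * ⟨ w , u ⟩ ≡ 0#
    c*wu≡0 = begin
      c * ⟨ w , u ⟩                    ≡⟨ sym (+-identityʳ _) ⟩
      c * ⟨ w , u ⟩ + 0#               ≡⟨ cong₂ _+_ (sym (⟨⟩-∙ʳ w c u)) (sym (⟨⟩-lc≡0 w cs wL≡0)) ⟩
      ⟨ w , c ∙ u ⟩ + ⟨ w , lc cs L ⟩  ≡⟨ sym (⟨⟩-distribʳ-⊞ w (c ∙ u) (lc cs L)) ⟩
      ⟨ w , c ∙ u ⊞ lc cs L ⟩          ≡⟨ cong ⟨ w ,_⟩ lc≡0 ⟩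
      ⟨ w , 0ᵛ ⟩                       ≡⟨ ⟨⟩-zeroʳ w ⟩
      0#                               ∎
    c≡0 : c ≡ 0#
    c≡0 = x≢0∧x*y≡0⇒y≡0 wu≢0 (trans (*-comm _ c) c*wu≡0)
    lcL≡0 : lc cs L ≡ 0ᵛ
    lcL≡0 = begin
      lc cs L               ≡⟨ sym (⊞-identityˡ _) ⟩
      0ᵛ ⊞ lc cs L          ≡⟨ cong (_⊞ lc cs L) (sym (trans (cong (_∙ u) c≡0) (∙-zeroˡ u))) ⟩
      c ∙ u ⊞ lc cs L       ≡⟨ lc≡0 ⟩
      0ᵛ                    ∎

  ⊞-swap : ∀ {n} (x y z : V n) → x ⊞ (y ⊞ z) ≡ y ⊞ (x ⊞ z)
  ⊞-swap []      []      []      = refl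
  ⊞-swap (a ∷ x) (b ∷ y) (c ∷ z) =
    cong₂ _∷_ (solve 3 (λ a b c → a :+ (b :+ c) := b :+ (a :+ c)) refl a b c) (⊞-swap x y z)

  lc-↭ : ∀ {n} {L L′ : List (V n)} → L ↭ L′ → ∀ cs → length cs ≡ length L′ →
         ∃ λ cs′ → length cs′ ≡ length L × lc cs′ L ≡ lc cs L′ × cs′ ↭ cs
  lc-↭ ↭.refl cs len = cs , len , refl , ↭-refl
  lc-↭ (↭.prep x p) (c ∷ cs) len with lc-↭ p cs (ℕ.suc-injective len)
  ... | cs′ , len′ , eq , q = c ∷ cs′ , cong suc len′ , cong (c ∙ x ⊞_) eq , ↭-prep c q
  lc-↭ (↭.swap x y p) (c₁ ∷ c₂ ∷ cs) len with lc-↭ p cs (ℕ.suc-injective (ℕ.suc-injective len))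
  ... | cs′ , len′ , eq , q =
    c₂ ∷ c₁ ∷ cs′ , cong (suc ∘ suc) len′ ,
    trans (cong (λ r → c₂ ∙ x ⊞ (c₁ ∙ y ⊞ r)) eq) (⊞-swap (c₂ ∙ x) (c₁ ∙ y) _) ,
    ↭-swap c₂ c₁ q
  lc-↭ (↭.trans p p′) cs len with lc-↭ p′ cs len
  ... | cs₁ , len₁ , eq₁ , q₁ with lc-↭ p cs₁ len₁
  ...   | cs₂ , len₂ , eq₂ , q₂ = cs₂ , len₂ , trans eq₂ eq₁ , ↭-trans q₂ q₁

  independent-↭ : ∀ {n} {L L′ : List (V n)} → L ↭ L′ → Independent L → Independent L′
  independent-↭ p indep cs len lc≡0 with lc-↭ p cs len
  ... | cs′ , len′ , eq , q = All-resp-↭ q (indep cs′ len′ (trans eq lc≡0))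

  head-⊞ : ∀ {n} (x y : V (suc n)) → head (x ⊞ y) ≡ head x + head y
  head-⊞ (a ∷ x) (b ∷ y) = refl

  head-∙ : ∀ {n} c (x : V (suc n)) → head (c ∙ x) ≡ c * head x
  head-∙ c (a ∷ x) = refl

  lc-head-tail : ∀ {n} cs (L : List (V (suc n))) → lc cs L ≡ head (lc cs L) ∷ lc cs (map tail L)
  lc-head-tail []       L              = refl
  lc-head-tail (c ∷ cs) []             = refl
  lc-head-tail (c ∷ cs) ((a ∷ v) ∷ L) rewrite lc-head-tail cs L = refl

  head-lc≡0 : ∀ {n} cs {L : List (V (suc n))} → All (λ v → head v ≡ 0#) L → head (lc cs L) ≡ 0#
  head-lc≡0 []       _ = refl
  head-lc≡0 (c ∷ cs) [] = refl
  head-lc≡0 (c ∷ cs) {v ∷ L} (v₀≡0 ∷ L₀≡0) = begin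
    head (c ∙ v ⊞ lc cs L)            ≡⟨ head-⊞ (c ∙ v) (lc cs L) ⟩
    head (c ∙ v) + head (lc cs L)     ≡⟨ cong₂ _+_ (trans (head-∙ c v) (trans (cong (c *_) v₀≡0) (zeroʳ c)))
                                                  (head-lc≡0 cs L₀≡0) ⟩
    0# + 0#                           ≡⟨ +-identityʳ 0# ⟩
    0#                                ∎

  tail-independent : ∀ {n} {L : List (V (suc n))} →
                     (∀ cs → lc cs (map tail L) ≡ 0ᵛ → head (lc cs L) ≡ 0#) →
                     Independent L → Independent (map tail L)
  tail-independent {L = L} head≡0 indep cs len lc≡0 = indep cs (trans len (length-map tail L)) (begin
    lc cs L                             ≡⟨ lc-head-tail cs L ⟩
    head (lc cs L) ∷ lc cs (map tail L) ≡⟨ cong₂ _∷_ (head≡0 cs lc≡0) lc≡0 ⟩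
    0ᵛ                                  ∎)

  orthogonal-tail-independent : ∀ {n} {h : Carrier} {x : V n} {L} → h ≢ 0#
    → All (λ v → ⟨ h ∷ x , v ⟩ ≡ 0#) L → Independent L → Independent (map tail L)
  orthogonal-tail-independent {h = h} {x} {L} h≢0 orth = tail-independent head≡0
    where
    head≡0 : ∀ cs → lc cs (map tail L) ≡ 0ᵛ → head (lc cs L) ≡ 0#
    head≡0 cs lc≡0 = x≢0∧x*y≡0⇒y≡0 h≢0 (begin
      h * s                  ≡⟨ sym (+-identityʳ _) ⟩
      h * s + 0#             ≡⟨ cong (h * s +_) (sym (⟨⟩-zeroʳ x)) ⟩
      ⟨ h ∷ x , s ∷ 0ᵛ ⟩     ≡⟨ cong ⟨ h ∷ x ,_⟩ (sym (trans (lc-head-tail cs L) (cong (s ∷_) lc≡0))) ⟩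
      ⟨ h ∷ x , lc cs L ⟩    ≡⟨ ⟨⟩-lc≡0 (h ∷ x) cs orth ⟩
      0#                     ∎)
      where s = head (lc cs L)

  module Pivot {n} {h : Carrier} {x : V n} (h≢0 : h ≢ 0#) where

    pivot : V (suc n)
    pivot = h ∷ x

    h⁻¹ : Carrier
    h⁻¹ = proj₁ (inverse h h≢0)

    reduce : V (suc n) → V (suc n)
    reduce v = v ⊞ (- (head v * h⁻¹)) ∙ pivot

    head-reduce : ∀ v → head (reduce v) ≡ 0#
    head-reduce (a ∷ v) = begin
      a + (- (a * h⁻¹)) * h   ≡⟨ cong (a +_) (sym (-‿distribˡ-* (a * h⁻¹) h)) ⟩
      a - (a * h⁻¹) * h       ≡⟨ cong (λ t → a - t) a*h⁻¹*h≡a ⟩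
      a - a                   ≡⟨ -‿inverseʳ a ⟩
      0#                      ∎
      where
      a*h⁻¹*h≡a : (a * h⁻¹) * h ≡ a
      a*h⁻¹*h≡a = begin
        (a * h⁻¹) * h   ≡⟨ *-assoc a h⁻¹ h ⟩
        a * (h⁻¹ * h)   ≡⟨ cong (a *_) (trans (*-comm h⁻¹ h) (proj₂ (inverse h h≢0))) ⟩
        a * 1#          ≡⟨ *-identityʳ a ⟩
        a               ∎

    ⊞-∙-rearrange : ∀ {m} c t s (v r y : V m) →
                    c ∙ (v ⊞ t ∙ y) ⊞ (r ⊞ s ∙ y) ≡ (c ∙ v ⊞ r) ⊞ (c * t + s) ∙ y
    ⊞-∙-rearrange c t s []      []      []      = refl
    ⊞-∙-rearrange c t s (a ∷ v) (b ∷ r) (z ∷ y) = cong₂ _∷_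
      (solve 6 (λ c a t z b s → c :* (a :+ t :* z) :+ (b :+ s :* z) := (c :* a :+ b) :+ (c :* t :+ s) :* z)
             refl c a t z b s)
      (⊞-∙-rearrange c t s v r y)

    lc-map-reduce : ∀ cs R → ∃ λ k → lc cs (map reduce R) ≡ lc cs R ⊞ k ∙ pivot
    lc-map-reduce []       R = 0# , sym (trans (cong (0ᵛ ⊞_) (∙-zeroˡ pivot)) (⊞-identityˡ 0ᵛ))
    lc-map-reduce (c ∷ cs) [] = 0# , sym (trans (cong (0ᵛ ⊞_) (∙-zeroˡ pivot)) (⊞-identityˡ 0ᵛ))
    lc-map-reduce (c ∷ cs) (v ∷ R) with lc-map-reduce cs R
    ... | k , eq = c * (- (head v * h⁻¹)) + k ,
                   trans (cong (c ∙ reduce v ⊞_) eq) (⊞-∙-rearrange c _ k v (lc cs R) pivot)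

    reduce-independent : ∀ {R} → Independent (pivot ∷ R) → Independent (map reduce R)
    reduce-independent {R} indep cs len lc≡0 with lc-map-reduce cs R
    ... | k , eq with indep (k ∷ cs) (cong suc (trans len (length-map reduce R)))
                            (trans (⊞-comm (k ∙ pivot) (lc cs R)) (trans (sym eq) lc≡0))
    ...   | _ ∷ cs≡0 = cs≡0

    ⟨⟩-reduce≡0 : ∀ y v → ⟨ y , pivot ⟩ ≡ 0# → ⟨ y , v ⟩ ≡ 0# → ⟨ y , reduce v ⟩ ≡ 0#
    ⟨⟩-reduce≡0 y v y⊥pivot y⊥v = begin
      ⟨ y , v ⊞ t ∙ pivot ⟩              ≡⟨ ⟨⟩-distribʳ-⊞ y v (t ∙ pivot) ⟩
      ⟨ y , v ⟩ + ⟨ y , t ∙ pivot ⟩      ≡⟨ cong₂ _+_ y⊥v (⟨⟩-∙ʳ≡0 y t y⊥pivot) ⟩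
      0# + 0#                            ≡⟨ +-identityʳ 0# ⟩
      0#                                 ∎
      where t = - (head v * h⁻¹)

  independent-V0 : (L : List (V 0)) → Independent L → L ≡ []
  independent-V0 []      _     = refl
  independent-V0 (v ∷ L) indep with indep (1# ∷ replicate (length L) 0#)
                                           (cong suc (length-replicate (length L))) (V0≡[] _)
    where
    V0≡[] : (z : V 0) → z ≡ 0ᵛ
    V0≡[] [] = refl
  ... | 1≡0 ∷ _ = ⊥-elim (0≢1 (sym 1≡0))

  zero-heads-or-pivot : ∀ {n} (W : List (V (suc n))) →
    All (λ v → head v ≡ 0#) W ⊎ ∃₂ λ x R → head x ≢ 0# × W ↭ x ∷ R
  zero-heads-or-pivot []      = inj₁ []
  zero-heads-or-pivot (v ∷ W) with head v ≟ 0#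
  ... | no  v₀≢0 = inj₂ (v , W , v₀≢0 , ↭-refl)
  ... | yes v₀≡0 with zero-heads-or-pivot W
  ...   | inj₁ W₀≡0                 = inj₁ (v₀≡0 ∷ W₀≡0)
  ...   | inj₂ (x , R , x₀≢0 , W↭) = inj₂ (x , v ∷ R , x₀≢0 , ↭-trans (↭-prep v W↭) (↭-swap v x ↭-refl))

  OrthogonalBound : ℕ → Set
  OrthogonalBound n = ∀ (U W : List (V n)) → Independent U → Independent W → Orthogonal U W →
                      length U +ℕ length W ≤ n

  -- Eliminating the first coordinate with a pivot of W, orthogonal to all of U, loses one vector of W.
  pivot-bound : ∀ {n} → OrthogonalBound n → ∀ (U : List (V (suc n))) {W x R} → head x ≢ 0# → W ↭ x ∷ R →
                Independent U → Independent W → Orthogonal U W → length U +ℕ length W ≤ suc n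
  pivot-bound {n} bound U {W} {h ∷ x} {R} h≢0 W↭ indU indW U⊥W =
    subst (_≤ suc n) lengths (s≤s (bound U′ R′ indU′ indR′ U′⊥R′))
    where
    open Pivot h≢0
    U⊥ : ∀ {u v} → u ∈ U → v ∈ pivot ∷ R → ⟨ u , v ⟩ ≡ 0#
    U⊥ u∈U v∈ = U⊥W u∈U (∈-resp-↭ (↭-sym W↭) v∈)
    U′ R′ : List (V n)
    U′ = map tail U
    R′ = map tail (map reduce R)
    lengthR′ : length R′ ≡ length R
    lengthR′ = trans (length-map tail (map reduce R)) (length-map reduce R)
    lengths : suc (length U′ +ℕ length R′) ≡ length U +ℕ length W
    lengths = begin
      suc (length U′ +ℕ length R′)  ≡⟨ cong suc (cong₂ _+ℕ_ (length-map tail U) lengthR′) ⟩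
      suc (length U +ℕ length R)    ≡⟨ sym (ℕ.+-suc (length U) (length R)) ⟩
      length U +ℕ suc (length R)    ≡⟨ cong (length U +ℕ_) (sym (↭-length W↭)) ⟩
      length U +ℕ length W          ∎
    indU′ : Independent U′
    indU′ = orthogonal-tail-independent h≢0
              (All.tabulate (λ {u} u∈U → trans (⟨⟩-comm pivot u) (U⊥ u∈U (here refl)))) indU
    indR′ : Independent R′
    indR′ = tail-independent (λ cs _ → head-lc≡0 cs (All.tabulate head≡0))
              (reduce-independent (independent-↭ W↭ indW))
      where
      head≡0 : ∀ {w} → w ∈ map reduce R → head w ≡ 0#
      head≡0 w∈ with ∈-map⁻ reduce w∈
      ... | v , _ , refl = head-reduce v
    U′⊥R′ : Orthogonal U′ R′
    U′⊥R′ u∈ w∈ with ∈-map⁻ tail u∈ | ∈-map⁻ tail w∈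
    ... | u , u∈U , refl | w , w∈ , refl with ∈-map⁻ reduce w∈
    ...   | v , v∈R , refl = trans (⟨⟩-tail u (reduce v) (head-reduce v))
                                   (⟨⟩-reduce≡0 u v (U⊥ u∈U (here refl)) (U⊥ u∈U (there v∈R)))

  orthogonal-bound : ∀ n → OrthogonalBound n
  orthogonal-bound zero    U W indU indW _ rewrite independent-V0 U indU | independent-V0 W indW = z≤n
  orthogonal-bound (suc n) U W indU indW U⊥W with zero-heads-or-pivot W
  ... | inj₂ (_ , _ , x₀≢0 , W↭) = pivot-bound (orthogonal-bound n) U x₀≢0 W↭ indU indW U⊥W
  ... | inj₁ W₀≡0 with zero-heads-or-pivot U
  ...   | inj₂ (_ , _ , x₀≢0 , U↭) =
    subst (_≤ suc n) (ℕ.+-comm (length W) (length U))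
      (pivot-bound (orthogonal-bound n) W x₀≢0 U↭ indW indU
        (λ {w} {u} w∈ u∈ → trans (⟨⟩-comm w u) (U⊥W u∈ w∈)))
  ...   | inj₁ U₀≡0 = ℕ.m≤n⇒m≤1+n (subst₂ (λ a b → a +ℕ b ≤ n) (length-map tail U) (length-map tail W)
      (orthogonal-bound n (map tail U) (map tail W)
        (zero-heads-independent U₀≡0 indU) (zero-heads-independent W₀≡0 indW) tails⊥))
    where
    zero-heads-independent : ∀ {L : List (V (suc n))} → All (λ v → head v ≡ 0#) L →
                             Independent L → Independent (map tail L)
    zero-heads-independent L₀≡0 = tail-independent (λ cs _ → head-lc≡0 cs L₀≡0)
    tails⊥ : Orthogonal (map tail U) (map tail W)
    tails⊥ u∈ w∈ with ∈-map⁻ tail u∈ | ∈-map⁻ tail w∈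
    ... | u , u∈U , refl | w , w∈W , refl = trans (⟨⟩-tail u w (All.lookup W₀≡0 w∈W)) (U⊥W u∈U w∈W)

  independent-length≤ : ∀ {n} (L : List (V n)) → Independent L → length L ≤ n
  independent-length≤ {n} L indL =
    subst (_≤ n) (ℕ.+-identityʳ (length L)) (orthogonal-bound n L [] indL []-independent (λ _ ()))

module Colouring {q : ℕ} (𝔽 : FiniteField q)
                 (_≺_ : FiniteField.Carrier 𝔽 → FiniteField.Carrier 𝔽 → Set)
                 (≺-sto : IsStrictTotalOrder _≡_ _≺_) where

  open LinearAlgebra 𝔽
  open FiniteField 𝔽 using (Carrier; _≟_)
  open CommutativeRing commutativeRing using (_+_; 0#; +-comm; ring)
  open import Algebra.Properties.Ring ring using (+-cancelʳ; +-cancelˡ)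
  open IsStrictTotalOrder ≺-sto using (compare; asym)

  ≢⇒≺⊎≻ : ∀ {x y} → x ≢ y → x ≺ y ⊎ y ≺ x
  ≢⇒≺⊎≻ {x} {y} x≢y with compare x y
  ... | tri< x<y _ _ = inj₁ x<y
  ... | tri≈ _ x≡y _ = ⊥-elim (x≢y x≡y)
  ... | tri> _ _ y<x = inj₂ y<x

  SumAt : ∀ {d} → Fin d → Carrier → V d → V d → Set
  SumAt i s x y = lookup x i + lookup y i ≡ s × lookup x i ≢ lookup y i

  ProductOfLesser : ∀ {d} → (Carrier → Carrier → Set) → Fin d → V d → V d → Set
  ProductOfLesser _<_ i x y = (lookup x i < lookup y i → ⟨ x , y ⟩ ≡ ⟨ x , x ⟩)
                            × (lookup y i < lookup x i → ⟨ x , y ⟩ ≡ ⟨ y , y ⟩)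

  HasColour : ∀ {d} → V d → V d → Color 𝔽 d → Set
  HasColour x y (DOT c)    = ⟨ x , y ⟩ ≡ c × c ≢ 0# × c ≢ ⟨ x , x ⟩ × c ≢ ⟨ y , y ⟩
  HasColour x y (ZERO i s) = SumAt i s x y × ⟨ x , y ⟩ ≡ 0#
  HasColour x y (UP i s)   = SumAt i s x y × ProductOfLesser _≺_ i x y
  HasColour x y (DOWN i s) = SumAt i s x y × ProductOfLesser (flip _≺_) i x y

  SumAt-sym : ∀ {d} {i : Fin d} {s x y} → SumAt i s x y → SumAt i s y x
  SumAt-sym (sum≡ , x≢y) = trans (+-comm _ _) sum≡ , x≢y ∘ sym

  ProductOfLesser-sym : ∀ {d} {_<_} {i : Fin d} {x y} → ProductOfLesser _<_ i x y → ProductOfLesser _<_ i y x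
  ProductOfLesser-sym {x = x} {y} (x<y⇒ , y<x⇒) =
    (λ y<x → trans (⟨⟩-comm y x) (y<x⇒ y<x)) , (λ x<y → trans (⟨⟩-comm y x) (x<y⇒ x<y))

  HasColour-sym : ∀ {d} {x y : V d} γ → HasColour x y γ → HasColour y x γ
  HasColour-sym {x = x} {y} (DOT c) (xy≡c , c≢0 , c≢xx , c≢yy) = trans (⟨⟩-comm y x) xy≡c , c≢0 , c≢yy , c≢xx
  HasColour-sym {x = x} {y} (ZERO i s) (sum , xy≡0) = SumAt-sym {x = x} {y} sum , trans (⟨⟩-comm y x) xy≡0
  HasColour-sym {x = x} {y} (UP i s)   (sum , lesser) =
    SumAt-sym {x = x} {y} sum , ProductOfLesser-sym {_<_ = _≺_} {x = x} {y} lesser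
  HasColour-sym {x = x} {y} (DOWN i s) (sum , lesser) =
    SumAt-sym {x = x} {y} sum , ProductOfLesser-sym {_<_ = flip _≺_} {x = x} {y} lesser

  firstDiff-differs : ∀ {d} (x y : V d) {i} → firstDiff 𝔽 _≺_ ≺-sto x y ≡ just i → lookup x i ≢ lookup y i
  firstDiff-differs (a ∷ x) (b ∷ y) eq with a ≟ b
  firstDiff-differs (a ∷ x) (b ∷ y) refl | no a≢b = a≢b
  ... | yes _ with firstDiff 𝔽 _≺_ ≺-sto x y in eq′
  firstDiff-differs (a ∷ x) (b ∷ y) refl | yes _ | just j = firstDiff-differs x y eq′

  colorOrd-HasColour : ∀ {d} (u v : V d) i → lookup u i ≺ lookup v i → lookup u i ≢ lookup v i →
                       HasColour u v (colorOrd 𝔽 _≺_ ≺-sto u v i)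
  colorOrd-HasColour u v i u<v u≢v with dot 𝔽 _≺_ ≺-sto u v ≟ 0#
  ... | yes uv≡0 = (refl , u≢v) , uv≡0
  ... | no uv≢0 with dot 𝔽 _≺_ ≺-sto u v ≟ dot 𝔽 _≺_ ≺-sto u u
  ...   | yes uv≡uu = (refl , u≢v) , (λ _ → uv≡uu) , (λ v<u → ⊥-elim (asym u<v v<u))
  ...   | no uv≢uu with dot 𝔽 _≺_ ≺-sto u v ≟ dot 𝔽 _≺_ ≺-sto v v
  ...     | yes uv≡vv = (refl , u≢v) , (λ v<u → ⊥-elim (asym u<v v<u)) , (λ _ → uv≡vv)
  ...     | no uv≢vv  = refl , uv≢0 , uv≢uu , uv≢vv

  φ⇒HasColour : ∀ {d} (x y : V d) {γ} → φ 𝔽 _≺_ ≺-sto x y ≡ just γ → HasColour x y γ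
  φ⇒HasColour x y eq with firstDiff 𝔽 _≺_ ≺-sto x y in diff
  ... | just i with compare (lookup x i) (lookup y i)
  ...   | tri< x<y _ _ = subst (HasColour x y) (just-injective eq) (colorOrd-HasColour x y i x<y (firstDiff-differs x y diff))
  ...   | tri≈ _ x≡y _ = ⊥-elim (firstDiff-differs x y diff x≡y)
  ...   | tri> _ _ y<x = subst (HasColour x y) (just-injective eq)
                           (HasColour-sym _ (colorOrd-HasColour y x i y<x (firstDiff-differs x y diff ∘ sym)))

  module _ {d : ℕ} where

    ConstantOn : (V d → Set) → V d → Set
    ConstantOn P w = ∀ {y y′} → P y → P y′ → ⟨ w , y ⟩ ≡ ⟨ w , y′ ⟩

    ConstantOn-≡ : ∀ {P : V d → Set} w c → (∀ {y} → P y → ⟨ w , y ⟩ ≡ c) → ConstantOn P w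
    ConstantOn-≡ _ _ eq Py Py′ = trans (eq Py) (sym (eq Py′))

    -- The span of the differences of P, described as the vectors orthogonal to
    -- every w that is constant on P, so that no spans need to be formed.
    InDiffSpan : (V d → Set) → V d → Set
    InDiffSpan P v = ∀ w → ConstantOn P w → ⟨ w , v ⟩ ≡ 0#

    Separated : (V d → Set) → V d → Set
    Separated P u = Σ (V d) λ w → ConstantOn P w × (∀ {y} → P y → ⟨ w , u ⟩ ≢ ⟨ w , y ⟩)

    record IndepInDiffSpan (P : V d → Set) : Set where
      field
        vectors     : List (V d)
        independent : Independent vectors
        inDiffSpan  : All (InDiffSpan P) vectors
    open IndepInDiffSpan public

    ⊟-InDiffSpan : ∀ {P : V d → Set} {x y} → P x → P y → InDiffSpan P (x ⊟ y)
    ⊟-InDiffSpan Px Py w w-const = ⟨⟩-⊟ʳ≡0 w _ _ (w-const Px Py)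

    InDiffSpan-mono : ∀ {P Q : V d → Set} → (∀ {v} → Q v → P v) → ∀ {v} → InDiffSpan Q v → InDiffSpan P v
    InDiffSpan-mono Q⊆P v∈ w w-const = v∈ w (λ Qy Qy′ → w-const (Q⊆P Qy) (Q⊆P Qy′))

    extend : ∀ {P Q : V d → Set} {u y₀} → Separated Q u → Q y₀ → P u → (∀ {v} → Q v → P v) →
             IndepInDiffSpan Q → IndepInDiffSpan P
    extend {u = u} {y₀} (w , w-const , w-separates) Qy₀ Pu Q⊆P F = record
      { vectors     = u ⊟ y₀ ∷ vectors F
      ; independent = ∷-independent w (⟨⟩-⊟ʳ≢0 w u y₀ (w-separates Qy₀))
                                    (All.map (λ v∈ → v∈ w w-const) (inDiffSpan F)) (independent F)
      ; inDiffSpan  = ⊟-InDiffSpan Pu (Q⊆P Qy₀) ∷ All.map (InDiffSpan-mono Q⊆P) (inDiffSpan F)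
      }

    e-ConstantOn : ∀ {P : V d → Set} i → (∀ {y y′} → P y → P y′ → lookup y i ≡ lookup y′ i) →
                   ConstantOn P (e i)
    e-ConstantOn i same Py Py′ = trans (⟨e,⟩≡lookup i _) (trans (same Py Py′) (sym (⟨e,⟩≡lookup i _)))

    separated-by-SumAt : ∀ {P : V d → Set} {i s u} → (∀ {y} → P y → SumAt i s y u) → Separated P u
    separated-by-SumAt {i = i} {s} {u} sum =
      e i , e-ConstantOn i (λ Py Py′ → +-cancelʳ (lookup u i) _ _ (trans (proj₁ (sum Py)) (sym (proj₁ (sum Py′))))) ,
      λ {y} Py eq → proj₂ (sum Py) (sym (trans (sym (⟨e,⟩≡lookup i u)) (trans eq (⟨e,⟩≡lookup i y))))

    separated-by-colour : ∀ {P : V d → Set} {u} γ → (∀ {y} → P y → HasColour y u γ) → Separated P u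
    separated-by-colour {u = u} (DOT c) col =
      u , ConstantOn-≡ u c (λ {y} Py → trans (⟨⟩-comm u y) (proj₁ (col Py))) ,
      λ {y} Py uu≡uy → proj₂ (proj₂ (proj₂ (col Py))) (sym (trans uu≡uy (trans (⟨⟩-comm u y) (proj₁ (col Py)))))
    separated-by-colour (ZERO i s) col = separated-by-SumAt (proj₁ ∘ col)
    separated-by-colour (UP i s)   col = separated-by-SumAt (proj₁ ∘ col)
    separated-by-colour (DOWN i s) col = separated-by-SumAt (proj₁ ∘ col)

    CodimAtLeast : ℕ → (V d → Set) → Set
    CodimAtLeast j P = (F : IndepInDiffSpan P) → length (vectors F) +ℕ j ≤ d

    codim-zero : ∀ {P} → CodimAtLeast 0 P
    codim-zero F = subst (_≤ d) (sym (ℕ.+-identityʳ _)) (independent-length≤ (vectors F) (independent F))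

    codim-suc : ∀ {P Q : V d → Set} {u y₀ j} → CodimAtLeast j P → Separated Q u → Q y₀ → P u →
                (∀ {v} → Q v → P v) → CodimAtLeast (suc j) Q
    codim-suc {j = j} codim sep Qy₀ Pu Q⊆P F =
      subst (_≤ d) (sym (ℕ.+-suc (length (vectors F)) j)) (codim (extend sep Qy₀ Pu Q⊆P F))

    codim-mono : ∀ {P Q : V d → Set} {j} → (∀ {v} → Q v → P v) → CodimAtLeast j P → CodimAtLeast j Q
    codim-mono Q⊆P codim F = codim (record
      { vectors = vectors F ; independent = independent F ; inDiffSpan = All.map (InDiffSpan-mono Q⊆P) (inDiffSpan F) })

    InChain : ∀ {T} → List (V d) → (Fin T → V d) → V d → Set
    InChain S a v = v ∈ S ⊎ ∃ λ k → v ≡ a k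

    chain-codim : ∀ {S s₀} → s₀ ∈ S → ∀ T (a : Fin T → V d) (α : Fin T → Color 𝔽 d) →
                  (∀ i j → i <ᶠ j → φ 𝔽 _≺_ ≺-sto (a i) (a j) ≡ just (α i)) →
                  (∀ i s → s ∈ S → φ 𝔽 _≺_ ≺-sto (a i) s ≡ just (α i)) →
                  ∀ {j} → CodimAtLeast j (InChain S a) → CodimAtLeast (j +ℕ T) (_∈ S)
    chain-codim {S} s₀∈S zero a α _ _ {j} codim =
      subst (λ k → CodimAtLeast k (_∈ S)) (sym (ℕ.+-identityʳ j)) (codim-mono inj₁ codim)
    chain-codim {S} s₀∈S (suc T) a α a-chain a-S {j} codim =
      subst (λ k → CodimAtLeast k (_∈ S)) (sym (ℕ.+-suc j T))
        (chain-codim s₀∈S T (a ∘ Fin.suc) (α ∘ Fin.suc)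
          (λ i k i<k → a-chain (Fin.suc i) (Fin.suc k) (s≤s i<k)) (λ i → a-S (Fin.suc i))
          (codim-suc codim (separated-by-colour (α Fin.zero) colour) (inj₁ s₀∈S) (inj₂ (Fin.zero , refl)) later⊆))
      where
      colour : ∀ {y} → InChain S (a ∘ Fin.suc) y → HasColour y (a Fin.zero) (α Fin.zero)
      colour (inj₁ y∈S)      = HasColour-sym (α Fin.zero) (φ⇒HasColour _ _ (a-S Fin.zero _ y∈S))
      colour (inj₂ (k , refl)) = HasColour-sym (α Fin.zero) (φ⇒HasColour _ _ (a-chain Fin.zero (Fin.suc k) (s≤s z≤n)))
      later⊆ : ∀ {v} → InChain S (a ∘ Fin.suc) v → InChain S a v
      later⊆ (inj₁ v∈S)       = inj₁ v∈S
      later⊆ (inj₂ (k , v≡)) = inj₂ (Fin.suc k , v≡)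

    constant-side-bound : ∀ {P Q : V d → Set} {q₀} (w₀ : V d) → (∀ {y} → Q y → ConstantOn P y) →
      ConstantOn Q w₀ → ⟨ w₀ , q₀ ⟩ ≢ 0# → Q q₀ → (FP : IndepInDiffSpan P) (FQ : IndepInDiffSpan Q) →
      suc (length (vectors FP) +ℕ length (vectors FQ)) ≤ d
    constant-side-bound {P} {Q} {q₀} w₀ Q-const w₀-const w₀q₀≢0 Qq₀ FP FQ =
      subst (_≤ d) (ℕ.+-suc (length (vectors FP)) (length (vectors FQ)))
        (orthogonal-bound d (vectors FP) (q₀ ∷ vectors FQ) (independent FP)
          (∷-independent w₀ w₀q₀≢0 (All.map (λ v∈ → v∈ w₀ w₀-const) (inDiffSpan FQ)) (independent FQ)) FP⊥)
      where
      ⊥Q : ∀ {u y} → u ∈ vectors FP → Q y → ⟨ u , y ⟩ ≡ 0#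
      ⊥Q {u} {y} u∈ Qy = trans (⟨⟩-comm u y) (All.lookup (inDiffSpan FP) u∈ y (Q-const Qy))
      FP⊥ : Orthogonal (vectors FP) (q₀ ∷ vectors FQ)
      FP⊥ u∈ (here refl) = ⊥Q u∈ Qq₀
      FP⊥ {u} u∈ (there v∈) = All.lookup (inDiffSpan FQ) v∈ u (ConstantOn-≡ u 0# (⊥Q u∈))

    Leftover′ : List (V d) → Set
    Leftover′ = Leftover 𝔽 _≺_ ≺-sto

    NonzeroOn : List (V d) → Set
    NonzeroOn X = ∀ {v} → v ∈ X → NonzeroVec 𝔽 _≺_ ≺-sto v

    record Split (X : List (V d)) : Set where
      field
        A B        : List (V d)
        A⊆X        : ∀ {v} → v ∈ A → v ∈ X
        B⊆X        : ∀ {v} → v ∈ B → v ∈ X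
        length-A+B : length A +ℕ length B ≡ length X
        γ          : Color 𝔽 d
        cross      : ∀ {a b} → a ∈ A → b ∈ B → HasColour a b γ
        a₀ b₀      : V d
        a₀∈A       : a₀ ∈ A
        b₀∈B       : b₀ ∈ B

    swap : ∀ {X} → Split X → Split X
    swap sp = record
      { A = B ; B = A ; A⊆X = B⊆X ; B⊆X = A⊆X
      ; length-A+B = trans (ℕ.+-comm (length B) (length A)) length-A+B
      ; γ = γ ; cross = λ b∈B a∈A → HasColour-sym γ (cross a∈A b∈B)
      ; a₀ = b₀ ; b₀ = a₀ ; a₀∈A = b₀∈B ; b₀∈B = a₀∈A
      }
      where open Split sp

    leftover-nonempty : ∀ {X} → Leftover′ X → ∃ (_∈ X)
    leftover-nonempty (single x) = x , here refl
    leftover-nonempty (split A B lA _ X↭ _ _ _ _ _) with leftover-nonempty lA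
    ... | a , a∈A = a , ∈-resp-↭ (↭-sym X↭) (∈-++⁺ˡ a∈A)

    toSplit : ∀ {X} A B → Leftover′ A → Leftover′ B → X ↭ A ++ B → ∀ γ →
              (∀ a b → a ∈ A → b ∈ B → φ 𝔽 _≺_ ≺-sto a b ≡ just γ) → Split X
    toSplit {X} A B lA lB X↭ γ φ≡γ = record
      { A = A ; B = B
      ; A⊆X = ∈-resp-↭ (↭-sym X↭) ∘ ∈-++⁺ˡ
      ; B⊆X = ∈-resp-↭ (↭-sym X↭) ∘ ∈-++⁺ʳ A
      ; length-A+B = sym (trans (↭-length X↭) (length-++ A))
      ; γ = γ ; cross = λ {a} {b} a∈A b∈B → φ⇒HasColour a b (φ≡γ a b a∈A b∈B)
      ; a₀ = proj₁ (leftover-nonempty lA) ; b₀ = proj₁ (leftover-nonempty lB)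
      ; a₀∈A = proj₂ (leftover-nonempty lA) ; b₀∈B = proj₂ (leftover-nonempty lB)
      }

    module _ {X} (sp : Split X) where
      open Split sp

      b₀-separated : Separated (_∈ A) b₀
      b₀-separated = separated-by-colour γ (λ a∈A → cross a∈A b₀∈B)

      codim-A : ∀ {j} → CodimAtLeast j (_∈ X) → CodimAtLeast (suc j) (_∈ A)
      codim-A codim = codim-suc codim b₀-separated a₀∈A (B⊆X b₀∈B) A⊆X

      module Coordinate (nz : NonzeroOn X) (i : Fin d) (s : Carrier)
                        (sum : ∀ {a b} → a ∈ A → b ∈ B → SumAt i s a b) where

        A-coord : ∀ {a} → a ∈ A → lookup a i ≡ lookup a₀ i
        A-coord a∈A = +-cancelʳ (lookup b₀ i) _ _ (trans (proj₁ (sum a∈A b₀∈B)) (sym (proj₁ (sum a₀∈A b₀∈B))))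

        B-coord : ∀ {b} → b ∈ B → lookup b i ≡ lookup b₀ i
        B-coord b∈B = +-cancelˡ (lookup a₀ i) _ _ (trans (proj₁ (sum a₀∈A b∈B)) (sym (proj₁ (sum a₀∈A b₀∈B))))

        e-ConstantOn-A : ConstantOn (_∈ A) (e i)
        e-ConstantOn-A = e-ConstantOn i (λ a∈A a′∈A → trans (A-coord a∈A) (sym (A-coord a′∈A)))

        e-ConstantOn-B : ConstantOn (_∈ B) (e i)
        e-ConstantOn-B = e-ConstantOn i (λ b∈B b′∈B → trans (B-coord b∈B) (sym (B-coord b′∈B)))

        ⟨e,a₀⟩≢0 : ⟨ e i , a₀ ⟩ ≢ 0#
        ⟨e,a₀⟩≢0 = nz (A⊆X a₀∈A) i ∘ trans (sym (⟨e,⟩≡lookup i a₀))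

        ⟨e,b₀⟩≢0 : ⟨ e i , b₀ ⟩ ≢ 0#
        ⟨e,b₀⟩≢0 = nz (B⊆X b₀∈B) i ∘ trans (sym (⟨e,⟩≡lookup i b₀))

      module SplitBound (nz : NonzeroOn X) (FA : IndepInDiffSpan (_∈ A)) (FB : IndepInDiffSpan (_∈ B)) where

        Goal : Set
        Goal = suc (length (vectors FA) +ℕ length (vectors FB)) ≤ d

        B-constant : ∀ w₀ → (∀ {b} → b ∈ B → ConstantOn (_∈ A) b) → ConstantOn (_∈ B) w₀ →
                     ⟨ w₀ , b₀ ⟩ ≢ 0# → Goal
        B-constant w₀ B-const w₀-const w₀b₀≢0 = constant-side-bound w₀ B-const w₀-const w₀b₀≢0 b₀∈B FA FB

        A-constant : ∀ w₀ → (∀ {a} → a ∈ A → ConstantOn (_∈ B) a) → ConstantOn (_∈ A) w₀ →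
                     ⟨ w₀ , a₀ ⟩ ≢ 0# → Goal
        A-constant w₀ A-const w₀-const w₀a₀≢0 = subst (_≤ d) (cong suc (ℕ.+-comm (length (vectors FB)) _))
          (constant-side-bound w₀ A-const w₀-const w₀a₀≢0 a₀∈A FB FA)

        -- Both coordinates at i are constant on their side, so one side is uniformly the lesser one.
        by-lesser : ∀ {_<_} i s → (∀ {x y} → x ≢ y → x < y ⊎ y < x) →
                    (∀ {a b} → a ∈ A → b ∈ B → SumAt i s a b × ProductOfLesser _<_ i a b) → Goal
        by-lesser {_<_} i s trichotomy col = [ A-lesser , B-lesser ]′ (trichotomy (proj₂ (proj₁ (col a₀∈A b₀∈B))))
          where
          open Coordinate nz i s (λ a∈A b∈B → proj₁ (col a∈A b∈B))
          A-lesser : lookup a₀ i < lookup b₀ i → Goal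
          A-lesser a₀<b₀ = A-constant (e i) (λ {a} a∈A → ConstantOn-≡ a ⟨ a , a ⟩ λ b∈B →
              proj₁ (proj₂ (col a∈A b∈B)) (subst₂ _<_ (sym (A-coord a∈A)) (sym (B-coord b∈B)) a₀<b₀))
            e-ConstantOn-A ⟨e,a₀⟩≢0
          B-lesser : lookup b₀ i < lookup a₀ i → Goal
          B-lesser b₀<a₀ = B-constant (e i) (λ {b} b∈B → ConstantOn-≡ b ⟨ b , b ⟩ λ {a} a∈A → trans (⟨⟩-comm b a)
              (proj₂ (proj₂ (col a∈A b∈B)) (subst₂ _<_ (sym (B-coord b∈B)) (sym (A-coord a∈A)) b₀<a₀)))
            e-ConstantOn-B ⟨e,b₀⟩≢0

        by-colour : ∀ γ′ → (∀ {a b} → a ∈ A → b ∈ B → HasColour a b γ′) → Goal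
        by-colour (DOT c) col =
          B-constant a₀ (λ {b} b∈B → ConstantOn-≡ b c λ {a} a∈A → trans (⟨⟩-comm b a) (proj₁ (col a∈A b∈B)))
            (ConstantOn-≡ a₀ c λ b∈B → proj₁ (col a₀∈A b∈B))
            (proj₁ (proj₂ (col a₀∈A b₀∈B)) ∘ trans (sym (proj₁ (col a₀∈A b₀∈B))))
        by-colour (ZERO i s) col =
          B-constant (e i) (λ {b} b∈B → ConstantOn-≡ b 0# λ {a} a∈A → trans (⟨⟩-comm b a) (proj₂ (col a∈A b∈B)))
            e-ConstantOn-B ⟨e,b₀⟩≢0
          where open Coordinate nz i s (λ a∈A b∈B → proj₁ (col a∈A b∈B))
        by-colour (UP i s)   col = by-lesser i s ≢⇒≺⊎≻ col
        by-colour (DOWN i s) col = by-lesser i s (Sum.swap ∘ ≢⇒≺⊎≻) col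

      split-bound : NonzeroOn X → (FA : IndepInDiffSpan (_∈ A)) (FB : IndepInDiffSpan (_∈ B)) →
                    suc (length (vectors FA) +ℕ length (vectors FB)) ≤ d
      split-bound nz FA FB = SplitBound.by-colour nz FA FB γ cross

    Rank : List (V d) → Set
    Rank X = Σ (IndepInDiffSpan (_∈ X)) λ F → length X ≤ 2 ^ length (vectors F)

    rank-grow : ∀ {X} (sp : Split X) (RA : Rank (Split.A sp)) (RB : Rank (Split.B sp)) →
                length (vectors (proj₁ RB)) ≤ length (vectors (proj₁ RA)) → Rank X
    rank-grow sp (FA , |A|≤) (FB , |B|≤) FB≤FA =
      extend (b₀-separated sp) a₀∈A (B⊆X b₀∈B) A⊆X FA ,
      subst (_≤ 2 ^ suc k) length-A+B (+-≤-2^suc k |A|≤ (ℕ.≤-trans |B|≤ (ℕ.^-monoʳ-≤ 2 FB≤FA)))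
      where
      open Split sp
      k = length (vectors FA)

    rank-combine : ∀ {X} (sp : Split X) → Rank (Split.A sp) → Rank (Split.B sp) → Rank X
    rank-combine sp RA RB with length (vectors (proj₁ RB)) ≤? length (vectors (proj₁ RA))
    ... | yes FB≤FA = rank-grow sp RA RB FB≤FA
    ... | no  FB≰FA = rank-grow (swap sp) RB RA (ℕ.≰⇒≥ FB≰FA)

    leftover-rank : ∀ {X} → Leftover′ X → Rank X
    leftover-rank (single x) =
      record { vectors = [] ; independent = []-independent ; inDiffSpan = [] } , s≤s z≤n
    leftover-rank (split A B lA lB X↭ _ γ φ≡γ _ _) =
      rank-combine (toSplit A B lA lB X↭ γ φ≡γ) (leftover-rank lA) (leftover-rank lB)

    Sequence : List (V d) → ℕ → Set
    Sequence X j = Σ (List ℕ) (GoodSequence (length X) d j)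

    Builder : List (V d) → Set
    Builder X = NonzeroOn X → ∀ j → CodimAtLeast j (_∈ X) → Sequence X j

    ∈⇒1≤length : ∀ {A : Set} {x : A} {xs} → x ∈ xs → 1 ≤ length xs
    ∈⇒1≤length (here _)  = s≤s z≤n
    ∈⇒1≤length (there _) = s≤s z≤n

    grow : ∀ {X j} (sp : Split X) → Rank (Split.A sp) → Rank (Split.B sp) →
           length (Split.B sp) ≤ length (Split.A sp) → NonzeroOn X → CodimAtLeast j (_∈ X) →
           Builder (Split.A sp) → Sequence X j
    grow {j = j} sp (FA , |A|≤) (FB , |B|≤) B≤A nz codim buildA =
      let xs , good = buildA (nz ∘ A⊆X) (suc j) (codim-A sp codim)
      in length B ∷ xs , subst (λ r → GoodSequence r d j (length B ∷ xs)) length-A+B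
                           (GoodSequence-∷ (∈⇒1≤length b₀∈B) B≤A logs<d log+j≤d good)
      where
      open Split sp
      logA : ⌈log₂ length A ⌉ ≤ length (vectors FA)
      logA = ⌈log₂⌉≤ |A|≤
      logs<d : ⌈log₂ length A ⌉ +ℕ ⌈log₂ length B ⌉ < d
      logs<d = ℕ.≤-trans (s≤s (ℕ.+-mono-≤ logA (⌈log₂⌉≤ |B|≤))) (split-bound sp nz FA FB)
      log+j≤d : ⌈log₂ length A ⌉ +ℕ suc j ≤ d
      log+j≤d = ℕ.≤-trans (ℕ.+-monoˡ-≤ (suc j) logA) (codim-A sp codim FA)

    build-split : ∀ {X} (sp : Split X) → Rank (Split.A sp) → Rank (Split.B sp) →
                  Builder (Split.A sp) → Builder (Split.B sp) → Builder X
    build-split sp RA RB buildA buildB nz j codim with length (Split.B sp) ≤? length (Split.A sp)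
    ... | yes B≤A = grow sp RA RB B≤A nz codim buildA
    ... | no  B≰A = grow (swap sp) RB RA (ℕ.≰⇒≥ B≰A) nz codim buildB

    build : ∀ {X} → Leftover′ X → Builder X
    build (single x) _ _ _ = [] , GoodSequence-[]
    build (split A B lA lB X↭ _ γ φ≡γ _ _) =
      build-split (toSplit A B lA lB X↭ γ φ≡γ) (leftover-rank lA) (leftover-rank lB) (build lA) (build lB)

lemma10 : (q : ℕ) → OddPrimePower q → (𝔽 : FiniteField q)
          → (_≺_ : FiniteField.Carrier 𝔽 → FiniteField.Carrier 𝔽 → Set)
          → (≺-sto : IsStrictTotalOrder _≡_ _≺_)
          → (d : ℕ) → 1 ≤ d → (p : ℕ) → 2 ≤ p → (T : ℕ)
          → (S : List (Vec (FiniteField.Carrier 𝔽) d))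
          → All (NonzeroVec 𝔽 _≺_ ≺-sto) S → Unique S → length S ≡ p
          → Leftover 𝔽 _≺_ ≺-sto S
          → (a : Fin T → Vec (FiniteField.Carrier 𝔽) d)
          → (∀ i → NonzeroVec 𝔽 _≺_ ≺-sto (a i))
          → (α : Fin T → Color 𝔽 d)
          → (∀ i j → i <ᶠ j → φ 𝔽 _≺_ ≺-sto (a i) (a j) ≡ just (α i))
          → (∀ i s → s ∈ S → φ 𝔽 _≺_ ≺-sto (a i) s ≡ just (α i))
          → Σ (List ℕ) (GoodSequence p d T)
lemma10 _ _ 𝔽 _≺_ ≺-sto d _ _ _ T S nonzero _ refl leftover a _ α a-chain a-S =
  build leftover (All.lookup nonzero) T
    (chain-codim (proj₂ (leftover-nonempty leftover)) T a α a-chain a-S codim-zero)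
  where open Colouring 𝔽 _≺_ ≺-sto
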